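{- Let $n$ be a non-negative integer and let $d_n(x)=\sum_{k=0}^n\binom{n}{k}\binom{x}{k}2^k$. Then $$d_n(x)^2=\sum_{k=0}^{n}\binom{n+k}{2k}\binom{x}{k}\binom{x+k}{k}4^k.$$
   Context: Here $\binom{x}{k}=x(x-1)\cdots(x-k+1)/k!$, and the identity is an identity of polynomials in $x$. -}

module Defs where

open import Data.Nat as ℕ using (ℕ; zero; suc; _!)
open import Data.Nat.Properties using (_!≢0)
open import Data.Nat.Combinatorics using (_C_)
open import Data.Integer as ℤ using (+_)
open import Data.Rational using (ℚ; _/_; _+_; _*_; _-_; 0ℚ; 1ℚ)

ℕ→ℚ : ℕ → ℚ
ℕ→ℚ n = (+ n) / 1

Σ[0…_] : ℕ → (ℕ → ℚ) → ℚ
Σ[0… zero ] f = f 0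
Σ[0… suc n ] f = Σ[0… n ] f + f (suc n)

falling : ℚ → ℕ → ℚ
falling x zero = 1ℚ
falling x (suc k) = falling x k * (x - ℕ→ℚ k)

binom : ℚ → ℕ → ℚ
binom x k = falling x k * (((+ 1) / (k !)) {{k !≢0}})

d : ℕ → ℚ → ℚ
d n x = Σ[0… n ] (λ k → ℕ→ℚ (n C k) * binom x k * ℕ→ℚ (2 ℕ.^ k))

{-# OPTIONS --safe #-}
module Submission where

-- Write m = 2x + 1. Multiplication by m is bidiagonal on the basis β_k = binom(x,k) 2^k,
-- m β_k = (k+1) β_{k+1} + (2k+1) β_k, and multiplication by m² is bidiagonal on the basis
-- w_k = binom(x,k) binom(x+k,k) 4^k, m² w_k = (k+1)² w_{k+1} + (2k+1)² w_k. Comparing coefficients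
-- (Pascal's rule and the absorption identity (k+1) C(n,k+1) = (n-k) C(n,k)) turns these into the
-- recurrence (n+2) d_{n+2} = m d_{n+1} + (n+1) d_n, and, for S_n = Σ C(n+k,2k) w_k (the right-hand side)
-- and T_n = Σ C(n+k+1,2k+1) w_k, into
--   T_{n+1} = S_{n+1} + T_n   and   (n+2)² S_{n+2} = m² (T_{n+1} + T_n) + (n+1)² S_n.
-- Squaring the recurrence of d shows that these relations propagate the triple
-- d_n² = S_n, d_{n+1}² = S_{n+1}, (n+1) d_n d_{n+1} = m T_n from n to n+1.

open import Data.List.Base using (_∷_; [])
open import Relation.Binary.PropositionalEquality

module BinomialIdentities where

  open import Data.Nat.Base
  open import Data.Nat.Properties using (+-suc; +-cancelʳ-≡; +-monoˡ-<; +-identityʳ; *-zeroʳ)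
  open import Data.Nat.Combinatorics using (_C_; nC1≡n; k>n⇒nCk≡0; nCk+nC[k+1]≡[n+1]C[k+1])
  open import Data.Nat.Tactic.RingSolver using (solve)
  open ≡-Reasoning

  shift : (ℕ → ℕ) → ℕ → ℕ
  shift f zero    = 0
  shift f (suc k) = f k

  _VanishesBeyond_ : (ℕ → ℕ) → ℕ → Set
  c VanishesBeyond N = ∀ {k} → N < k → c k ≡ 0

  infixl 8 _²

  _² : ℕ → ℕ
  n ² = n * n

  odd : ℕ → ℕ
  odd k = suc (2 * k)

  pascal : ∀ n k → suc n C suc k ≡ n C k + n C suc k
  pascal n k = sym (nCk+nC[k+1]≡[n+1]C[k+1] n k)

  private
    absorption-step : ∀ n k b₀ b₁ b₂ →
      (2 + k) * b₂ + (1 + k) * b₁ ≡ n * b₁ → (1 + k) * b₁ + k * b₀ ≡ n * b₀ →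
      (2 + k) * (b₁ + b₂) + (1 + k) * (b₀ + b₁) ≡ suc n * (b₀ + b₁)
    absorption-step n k b₀ b₁ b₂ e₁ e₀ = begin
      (2 + k) * (b₁ + b₂) + (1 + k) * (b₀ + b₁)
        ≡⟨ solve (k ∷ b₀ ∷ b₁ ∷ b₂ ∷ []) ⟩
      ((2 + k) * b₂ + (1 + k) * b₁) + ((1 + k) * b₁ + k * b₀) + (b₀ + b₁)
        ≡⟨ cong₂ (λ u v → u + v + (b₀ + b₁)) e₁ e₀ ⟩
      n * b₁ + n * b₀ + (b₀ + b₁)
        ≡⟨ solve (n ∷ b₀ ∷ b₁ ∷ []) ⟩
      suc n * (b₀ + b₁) ∎

  [1+k]*nC[1+k]+k*nCk≡n*nCk : ∀ n k → suc k * (n C suc k) + k * (n C k) ≡ n * (n C k)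
  [1+k]*nC[1+k]+k*nCk≡n*nCk zero    zero    = refl
  [1+k]*nC[1+k]+k*nCk≡n*nCk zero    (suc k) = cong₂ _+_ (*-zeroʳ (2 + k)) (*-zeroʳ (1 + k))
  [1+k]*nC[1+k]+k*nCk≡n*nCk (suc n) zero    rewrite nC1≡n (suc n) = solve (n ∷ [])
  [1+k]*nC[1+k]+k*nCk≡n*nCk (suc n) (suc k) rewrite pascal n (suc k) | pascal n k =
    absorption-step n k _ _ _ ([1+k]*nC[1+k]+k*nCk≡n*nCk n (suc k)) ([1+k]*nC[1+k]+k*nCk≡n*nCk n k)

  private
    C-recurrence-step : ∀ n j {A a₀ a₁ b₀ b₁} → A ≡ a₀ + a₁ → a₁ ≡ b₀ + b₁ →
      suc j * a₁ + j * a₀ ≡ suc n * a₀ → suc j * b₁ + j * b₀ ≡ n * b₀ →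
      (2 + n) * A ≡ a₀ * suc j + a₁ * suc (2 * suc j) + suc n * b₁
    C-recurrence-step n j {a₀ = a₀} {b₀ = b₀} {b₁} refl refl e₁ e₀ = begin
      (2 + n) * (a₀ + (b₀ + b₁))
        ≡⟨ solve (n ∷ a₀ ∷ b₀ ∷ b₁ ∷ []) ⟩
      (suc n * a₀ + n * b₀) + (a₀ + 2 * b₀ + (2 + n) * b₁)
        ≡⟨ cong (_+ (a₀ + 2 * b₀ + (2 + n) * b₁)) (sym (cong₂ _+_ e₁ e₀)) ⟩
      (suc j * (b₀ + b₁) + j * a₀ + (suc j * b₁ + j * b₀)) + (a₀ + 2 * b₀ + (2 + n) * b₁)
        ≡⟨ solve (n ∷ j ∷ a₀ ∷ b₀ ∷ b₁ ∷ []) ⟩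
      a₀ * suc j + (b₀ + b₁) * suc (2 * suc j) + suc n * b₁ ∎

  C-recurrence : ∀ n k →
    (2 + n) * ((2 + n) C k)
      ≡ shift (λ j → ((1 + n) C j) * suc j) k + ((1 + n) C k) * odd k + (1 + n) * (n C k)
  C-recurrence n zero    = solve (n ∷ [])
  C-recurrence n (suc j) = C-recurrence-step n j (pascal (suc n) j) (pascal n j)
    ([1+k]*nC[1+k]+k*nCk≡n*nCk (suc n) j) ([1+k]*nC[1+k]+k*nCk≡n*nCk n j)

  evenC oddC : ℕ → ℕ → ℕ
  evenC n k = (n + k) C (2 * k)
  oddC  n k = (suc n + k) C suc (2 * k)

  oddC-pascal : ∀ n k → oddC (suc n) k ≡ evenC (suc n) k + oddC n k
  oddC-pascal n k = pascal (suc n + k) (2 * k)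

  private
    n<k⇒n+k<2*k : ∀ {n k} → n < k → n + k < 2 * k
    n<k⇒n+k<2*k {n} {k} n<k = subst (n + k <_) (cong (k +_) (sym (+-identityʳ k))) (+-monoˡ-< k n<k)

  evenC-vanishes : ∀ n → evenC n VanishesBeyond n
  evenC-vanishes n n<k = k>n⇒nCk≡0 (n<k⇒n+k<2*k n<k)

  oddC-vanishes : ∀ n → oddC n VanishesBeyond n
  oddC-vanishes n n<k = k>n⇒nCk≡0 (s<s (n<k⇒n+k<2*k n<k))

  private
    2*[1+k]≡2+2*k : ∀ k → 2 * suc k ≡ 2 + 2 * k
    2*[1+k]≡2+2*k k = solve (k ∷ [])

    evenC-suc : ∀ n k → evenC n (suc k) ≡ suc (n + k) C (2 + 2 * k)
    evenC-suc n k = cong₂ _C_ (+-suc n k) (2*[1+k]≡2+2*k k)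

    oddC-suc : ∀ n k → oddC n (suc k) ≡ suc (suc (n + k)) C (3 + 2 * k)
    oddC-suc n k = cong₂ _C_ (cong suc (+-suc n k)) (cong suc (2*[1+k]≡2+2*k k))

    oddC-zero : ∀ n → oddC n 0 ≡ suc n
    oddC-zero n = trans (nC1≡n (suc n + 0)) (cong suc (+-identityʳ n))

    -- The two sides differ by the three absorption identities weighted by n+j+3, 2n+4j+9 and 4j+6;
    -- lacking subtraction in ℕ, the weighted identities are added to both sides and then cancelled.
    evenC-recurrence-step : ∀ n j {L X₀ X₁ E A₀ A₁ A₂ A₃} →
      L ≡ (A₀ + A₁) + (A₁ + A₂) → X₀ ≡ (A₀ + A₁) + A₁ →
      X₁ ≡ ((A₁ + A₂) + (A₂ + A₃)) + (A₂ + A₃) → E ≡ A₂ →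
      suc (2 * j) * A₁ + 2 * j * A₀ ≡ suc (n + j) * A₀ →
      (2 + 2 * j) * A₂ + suc (2 * j) * A₁ ≡ suc (n + j) * A₁ →
      (3 + 2 * j) * A₃ + (2 + 2 * j) * A₂ ≡ suc (n + j) * A₂ →
      (2 + n) * (2 + n) * L
        ≡ X₀ * (suc j * suc j) + X₁ * (suc (2 * suc j) * suc (2 * suc j)) + (1 + n) * (1 + n) * E
    evenC-recurrence-step n j {A₀ = A₀} {A₁} {A₂} {A₃} refl refl refl refl e₀ e₁ e₂ =
      +-cancelʳ-≡ _ _ _ (trans (cong ((2 + n) * (2 + n) * ((A₀ + A₁) + (A₁ + A₂)) +_) (sym weighted))
                               (solve (n ∷ j ∷ A₀ ∷ A₁ ∷ A₂ ∷ A₃ ∷ [])))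
      where
      weighted :
        (n + j + 3) * (suc (2 * j) * A₁ + 2 * j * A₀)
          + (2 * n + 4 * j + 9) * ((2 + 2 * j) * A₂ + suc (2 * j) * A₁)
          + (4 * j + 6) * ((3 + 2 * j) * A₃ + (2 + 2 * j) * A₂)
        ≡ (n + j + 3) * (suc (n + j) * A₀) + (2 * n + 4 * j + 9) * (suc (n + j) * A₁)
          + (4 * j + 6) * (suc (n + j) * A₂)
      weighted = cong₂ _+_ (cong₂ _+_ (cong ((n + j + 3) *_) e₀) (cong ((2 * n + 4 * j + 9) *_) e₁))
                           (cong ((4 * j + 6) *_) e₂)

  evenC-recurrence : ∀ n k →
    (2 + n) ² * evenC (2 + n) k
      ≡ shift (λ j → (oddC (1 + n) j + oddC n j) * suc j ²) k + (oddC (1 + n) k + oddC n k) * odd k ²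
        + (1 + n) ² * evenC n k
  evenC-recurrence n zero rewrite oddC-zero (suc n) | oddC-zero n = solve (n ∷ [])
  evenC-recurrence n (suc j) =
    evenC-recurrence-step n j
      (trans (evenC-suc (2 + n) j) (trans (pascal (suc M) (1 + r)) (cong₂ _+_ (pascal M r) (pascal M (1 + r)))))
      (cong (_+ oddC n j) (pascal M r))
      (cong₂ _+_
        (trans (oddC-suc (1 + n) j)
               (trans (pascal (suc M) (2 + r)) (cong₂ _+_ (pascal M (1 + r)) (pascal M (2 + r)))))
        (trans (oddC-suc n j) (pascal M (2 + r))))
      (evenC-suc n j)
      ([1+k]*nC[1+k]+k*nCk≡n*nCk M r)
      ([1+k]*nC[1+k]+k*nCk≡n*nCk M (1 + r))
      ([1+k]*nC[1+k]+k*nCk≡n*nCk M (2 + r))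
    where
    M r : ℕ
    M = suc (n + j)
    r = 2 * j

open BinomialIdentities

open import Algebra.Bundles using (CommutativeMonoid)
import Data.Integer.Base as ℤ
import Data.Integer.Properties as ℤP
open import Data.Nat.Base as ℕ using (ℕ; zero; suc; _!; s≤s)
import Data.Nat.Coprimality as Coprime
open import Data.Nat.Combinatorics using (_C_; k>n⇒nCk≡0)
import Data.Nat.Properties as ℕP
open import Data.Product.Base using (_×_; _,_; proj₁)
open import Data.Rational.Base using (ℚ; mkℚ; ↥_; _+_; _*_; _-_; _/_; 1/_; 0ℚ; 1ℚ; NonZero; ≢-nonZero)
import Data.Rational.Properties as ℚP
open import Data.Rational.Solver using (module +-*-Solver)
open import Function.Base using (_∘_)
open import Algebra.Properties.CommutativeSemigroup
  (CommutativeMonoid.commutativeSemigroup ℚP.+-0-commutativeMonoid)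
  using (interchange)
open import Algebra.Properties.CommutativeSemigroup
  (CommutativeMonoid.commutativeSemigroup ℚP.*-1-commutativeMonoid)
  using (x∙yz≈y∙xz; xy∙z≈xz∙y; xy∙z≈y∙xz)
  renaming (interchange to *-interchange)
open import Defs

ℕ→ℚ≡mkℚ : ∀ n → ℕ→ℚ n ≡ mkℚ (ℤ.+ n) 0 (Coprime.sym (Coprime.1-coprimeTo n))
ℕ→ℚ≡mkℚ n = ℚP.normalize-coprime (Coprime.sym (Coprime.1-coprimeTo n))

ℕ→ℚ-+ : ∀ m n → ℕ→ℚ (m ℕ.+ n) ≡ ℕ→ℚ m + ℕ→ℚ n
ℕ→ℚ-+ m n rewrite ℕ→ℚ≡mkℚ m | ℕ→ℚ≡mkℚ n = ℚP./-cong {q₁ = 1} {q₂ = 1}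
  (trans (ℤP.pos-+ m n) (sym (cong₂ ℤ._+_ (ℤP.*-identityʳ (ℤ.+ m)) (ℤP.*-identityʳ (ℤ.+ n))))) refl

ℕ→ℚ-* : ∀ m n → ℕ→ℚ (m ℕ.* n) ≡ ℕ→ℚ m * ℕ→ℚ n
ℕ→ℚ-* m n rewrite ℕ→ℚ≡mkℚ m | ℕ→ℚ≡mkℚ n = ℚP./-cong {q₁ = 1} {q₂ = 1} (ℤP.pos-* m n) refl

ℕ→ℚ-*-assoc : ∀ m n z → ℕ→ℚ (m ℕ.* n) * z ≡ ℕ→ℚ m * (ℕ→ℚ n * z)
ℕ→ℚ-*-assoc m n z = trans (cong (_* z) (ℕ→ℚ-* m n)) (ℚP.*-assoc (ℕ→ℚ m) (ℕ→ℚ n) z)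

ℕ→ℚ-odd : ∀ k → ℕ→ℚ (odd k) ≡ 1ℚ + ℕ→ℚ 2 * ℕ→ℚ k
ℕ→ℚ-odd k = trans (ℕ→ℚ-+ 1 (2 ℕ.* k)) (cong (1ℚ +_) (ℕ→ℚ-* 2 k))

ℕ→ℚ-nonZero : ∀ n .{{_ : ℕ.NonZero n}} → NonZero (ℕ→ℚ n)
ℕ→ℚ-nonZero n = ≢-nonZero λ n≡0 →
  ℕ.≢-nonZero⁻¹ n (ℤP.+-injective (cong ↥_ (trans (sym (ℕ→ℚ≡mkℚ n)) n≡0)))

1/n*n≡1 : ∀ n .{{_ : ℕ.NonZero n}} → (ℤ.+ 1 / n) * ℕ→ℚ n ≡ 1ℚ
1/n*n≡1 (suc n) rewrite ℕ→ℚ≡mkℚ (suc n) | ℚP.normalize-coprime {1} {n} (Coprime.1-coprimeTo (suc n)) =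
  ℚP.*-inverseˡ (mkℚ (ℤ.+ suc n) 0 (Coprime.sym (Coprime.1-coprimeTo (suc n))))

*-cancelʳ-≡ : ∀ {p q} r .{{_ : NonZero r}} → p * r ≡ q * r → p ≡ q
*-cancelʳ-≡ {p} {q} r pr≡qr = begin
  p                ≡⟨ sym (ℚP.*-identityʳ p) ⟩
  p * 1ℚ           ≡⟨ cong (p *_) (sym (ℚP.*-inverseʳ r)) ⟩
  p * (r * 1/ r)   ≡⟨ sym (ℚP.*-assoc p r (1/ r)) ⟩
  p * r * 1/ r     ≡⟨ cong (_* 1/ r) pr≡qr ⟩
  q * r * 1/ r     ≡⟨ ℚP.*-assoc q r (1/ r) ⟩
  q * (r * 1/ r)   ≡⟨ cong (q *_) (ℚP.*-inverseʳ r) ⟩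
  q * 1ℚ           ≡⟨ ℚP.*-identityʳ q ⟩
  q                ∎
  where open ≡-Reasoning

*-cancelˡ-square : ∀ {p q} r .{{_ : NonZero r}} → r * r * p ≡ r * r * q → p ≡ q
*-cancelˡ-square {p} {q} r rrp≡rrq = *-cancelʳ-≡ r (*-cancelʳ-≡ r (begin
  p * r * r    ≡⟨ rearrange p ⟩
  r * r * p    ≡⟨ rrp≡rrq ⟩
  r * r * q    ≡⟨ rearrange q ⟨
  q * r * r    ∎))
  where
  open ≡-Reasoning
  rearrange : ∀ z → z * r * r ≡ r * r * z
  rearrange z = trans (ℚP.*-assoc z r r) (ℚP.*-comm z (r * r))

Σ-cong : ∀ N {f g : ℕ → ℚ} → (∀ k → f k ≡ g k) → Σ[0… N ] f ≡ Σ[0… N ] g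
Σ-cong zero    f≗g = f≗g 0
Σ-cong (suc N) f≗g = cong₂ _+_ (Σ-cong N f≗g) (f≗g (suc N))

Σ-distrib-+ : ∀ N (f g : ℕ → ℚ) → Σ[0… N ] (λ k → f k + g k) ≡ Σ[0… N ] f + Σ[0… N ] g
Σ-distrib-+ zero    f g = refl
Σ-distrib-+ (suc N) f g = trans (cong (_+ (f (suc N) + g (suc N))) (Σ-distrib-+ N f g))
  (interchange (Σ[0… N ] f) (Σ[0… N ] g) (f (suc N)) (g (suc N)))

*-distribˡ-Σ : ∀ N c (f : ℕ → ℚ) → c * Σ[0… N ] f ≡ Σ[0… N ] (λ k → c * f k)
*-distribˡ-Σ zero    c f = refl
*-distribˡ-Σ (suc N) c f =
  trans (ℚP.*-distribˡ-+ c (Σ[0… N ] f) (f (suc N))) (cong (_+ c * f (suc N)) (*-distribˡ-Σ N c f))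

Σ-head : ∀ N (f : ℕ → ℚ) → Σ[0… suc N ] f ≡ f 0 + Σ[0… N ] (f ∘ suc)
Σ-head zero    f = refl
Σ-head (suc N) f = trans (cong (_+ f (2 ℕ.+ N)) (Σ-head N f)) (ℚP.+-assoc (f 0) _ _)

binom*k!≡falling : ∀ z k → binom z k * ℕ→ℚ (k !) ≡ falling z k
binom*k!≡falling z k = begin
  falling z k * (ℤ.+ 1 / k !) * ℕ→ℚ (k !)    ≡⟨ ℚP.*-assoc (falling z k) (ℤ.+ 1 / k !) (ℕ→ℚ (k !)) ⟩
  falling z k * ((ℤ.+ 1 / k !) * ℕ→ℚ (k !))  ≡⟨ cong (falling z k *_) (1/n*n≡1 (k !)) ⟩
  falling z k * 1ℚ                            ≡⟨ ℚP.*-identityʳ (falling z k) ⟩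
  falling z k                                 ∎
  where
  open ≡-Reasoning
  instance
    k!≢0 : ℕ.NonZero (k !)
    k!≢0 = k ℕP.!≢0

falling-+1 : ∀ z k → falling (z + 1ℚ) (suc k) ≡ (z + 1ℚ) * falling z k
falling-+1 z zero = solve 1 (λ z → con 1ℚ :* (z :+ con 1ℚ :- con 0ℚ) := (z :+ con 1ℚ) :* con 1ℚ) refl z
  where open +-*-Solver
falling-+1 z (suc k) = begin
  falling (z + 1ℚ) (suc k) * (z + 1ℚ - ℕ→ℚ (suc k))
    ≡⟨ cong₂ (λ u v → u * (z + 1ℚ - v)) (falling-+1 z k) (ℕ→ℚ-+ 1 k) ⟩
  (z + 1ℚ) * falling z k * (z + 1ℚ - (1ℚ + ℕ→ℚ k))
    ≡⟨ solve 3 (λ z f K → (z :+ con 1ℚ) :* f :* (z :+ con 1ℚ :- (con 1ℚ :+ K))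
                         := (z :+ con 1ℚ) :* (f :* (z :- K)))
         refl z (falling z k) (ℕ→ℚ k) ⟩
  (z + 1ℚ) * (falling z k * (z - ℕ→ℚ k)) ∎
  where
  open ≡-Reasoning
  open +-*-Solver

private
  *-cancelʳ-k! : ∀ {p q} k → p * ℕ→ℚ (k !) ≡ q * ℕ→ℚ (k !) → p ≡ q
  *-cancelʳ-k! k = *-cancelʳ-≡ (ℕ→ℚ (k !)) {{ℕ→ℚ-nonZero (k !) {{k ℕP.!≢0}}}}

  binom-suc*k!≡falling : ∀ z k → binom z (suc k) * ℕ→ℚ (suc k) * ℕ→ℚ (k !) ≡ falling z (suc k)
  binom-suc*k!≡falling z k = begin
    binom z (suc k) * ℕ→ℚ (suc k) * ℕ→ℚ (k !)    ≡⟨ ℚP.*-assoc (binom z (suc k)) (ℕ→ℚ (suc k)) (ℕ→ℚ (k !)) ⟩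
    binom z (suc k) * (ℕ→ℚ (suc k) * ℕ→ℚ (k !))  ≡⟨ cong (binom z (suc k) *_) (ℕ→ℚ-* (suc k) (k !)) ⟨
    binom z (suc k) * ℕ→ℚ (suc k !)              ≡⟨ binom*k!≡falling z (suc k) ⟩
    falling z (suc k)                             ∎
    where open ≡-Reasoning

binom-suc : ∀ z k → binom z (suc k) * ℕ→ℚ (suc k) ≡ binom z k * (z - ℕ→ℚ k)
binom-suc z k = *-cancelʳ-k! k (begin
  binom z (suc k) * ℕ→ℚ (suc k) * ℕ→ℚ (k !)  ≡⟨ binom-suc*k!≡falling z k ⟩
  falling z k * (z - ℕ→ℚ k)                   ≡⟨ cong (_* (z - ℕ→ℚ k)) (binom*k!≡falling z k) ⟨
  binom z k * ℕ→ℚ (k !) * (z - ℕ→ℚ k)         ≡⟨ xy∙z≈xz∙y (binom z k) (ℕ→ℚ (k !)) (z - ℕ→ℚ k) ⟩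
  binom z k * (z - ℕ→ℚ k) * ℕ→ℚ (k !)         ∎)
  where open ≡-Reasoning

binom-+1-suc : ∀ z k → binom (z + 1ℚ) (suc k) * ℕ→ℚ (suc k) ≡ (z + 1ℚ) * binom z k
binom-+1-suc z k = *-cancelʳ-k! k (begin
  binom (z + 1ℚ) (suc k) * ℕ→ℚ (suc k) * ℕ→ℚ (k !)  ≡⟨ binom-suc*k!≡falling (z + 1ℚ) k ⟩
  falling (z + 1ℚ) (suc k)                            ≡⟨ falling-+1 z k ⟩
  (z + 1ℚ) * falling z k                              ≡⟨ cong ((z + 1ℚ) *_) (binom*k!≡falling z k) ⟨
  (z + 1ℚ) * (binom z k * ℕ→ℚ (k !))                  ≡⟨ ℚP.*-assoc (z + 1ℚ) (binom z k) (ℕ→ℚ (k !)) ⟨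
  (z + 1ℚ) * binom z k * ℕ→ℚ (k !)                    ∎)
  where open ≡-Reasoning

module Expansion (β : ℕ → ℚ) where

  expand : (ℕ → ℕ) → ℕ → ℚ
  expand c N = Σ[0… N ] (λ k → ℕ→ℚ (c k) * β k)

  expand-cong : ∀ N (a b : ℕ → ℕ) → (∀ k → a k ≡ b k) → expand a N ≡ expand b N
  expand-cong N a b a≗b = Σ-cong N (λ k → cong (λ t → ℕ→ℚ t * β k) (a≗b k))

  expand-+ : ∀ N (a b : ℕ → ℕ) → expand (λ k → a k ℕ.+ b k) N ≡ expand a N + expand b N
  expand-+ N a b = trans
    (Σ-cong N (λ k → trans (cong (_* β k) (ℕ→ℚ-+ (a k) (b k))) (ℚP.*-distribʳ-+ (β k) (ℕ→ℚ (a k)) (ℕ→ℚ (b k)))))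
    (Σ-distrib-+ N (λ k → ℕ→ℚ (a k) * β k) (λ k → ℕ→ℚ (b k) * β k))

  expand-* : ∀ N q (a : ℕ → ℕ) → expand (λ k → q ℕ.* a k) N ≡ ℕ→ℚ q * expand a N
  expand-* N q a = trans
    (Σ-cong N (λ k → ℕ→ℚ-*-assoc q (a k) (β k)))
    (sym (*-distribˡ-Σ N (ℕ→ℚ q) (λ k → ℕ→ℚ (a k) * β k)))

  expand-suc : ∀ N (c : ℕ → ℕ) → c (suc N) ≡ 0 → expand c (suc N) ≡ expand c N
  expand-suc N c c[1+N]≡0 = begin
    expand c N + ℕ→ℚ (c (suc N)) * β (suc N)  ≡⟨ cong (λ t → expand c N + ℕ→ℚ t * β (suc N)) c[1+N]≡0 ⟩
    expand c N + 0ℚ * β (suc N)                ≡⟨ cong (expand c N +_) (ℚP.*-zeroˡ (β (suc N))) ⟩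
    expand c N + 0ℚ                            ≡⟨ ℚP.+-identityʳ (expand c N) ⟩
    expand c N                                 ∎
    where open ≡-Reasoning

  expand-extend : ∀ {N c} → c VanishesBeyond N → ∀ d → expand c (d ℕ.+ N) ≡ expand c N
  expand-extend         c≈0 zero    = refl
  expand-extend {N} {c} c≈0 (suc d) =
    trans (expand-suc (d ℕ.+ N) c (c≈0 (s≤s (ℕP.m≤n+m N d)))) (expand-extend c≈0 d)

  expand-shift : ∀ N (f : ℕ → ℕ) → expand (shift f) (suc N) ≡ Σ[0… N ] (λ k → ℕ→ℚ (f k) * β (suc k))
  expand-shift N f = begin
    expand (shift f) (suc N)         ≡⟨ Σ-head N (λ k → ℕ→ℚ (shift f k) * β k) ⟩
    ℕ→ℚ 0 * β 0 + Σ[0… N ] fβ∘suc  ≡⟨ cong (_+ Σ[0… N ] fβ∘suc) (ℚP.*-zeroˡ (β 0)) ⟩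
    0ℚ + Σ[0… N ] fβ∘suc           ≡⟨ ℚP.+-identityˡ (Σ[0… N ] fβ∘suc) ⟩
    Σ[0… N ] fβ∘suc                ∎
    where
    open ≡-Reasoning
    fβ∘suc : ℕ → ℚ
    fβ∘suc k = ℕ→ℚ (f k) * β (suc k)

module Bidiagonal (m : ℚ) (β : ℕ → ℚ) (α γ : ℕ → ℕ)
  (m*β : ∀ k → m * β k ≡ ℕ→ℚ (α k) * β (suc k) + ℕ→ℚ (γ k) * β k) where

  open Expansion β public

  *-expand : ∀ N (c : ℕ → ℕ) → c (suc N) ≡ 0 →
    m * expand c N ≡ expand (shift (λ j → c j ℕ.* α j)) (suc N) + expand (λ k → c k ℕ.* γ k) (suc N)
  *-expand N c c[1+N]≡0 = begin
    m * expand c N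
      ≡⟨ *-distribˡ-Σ N m (λ k → ℕ→ℚ (c k) * β k) ⟩
    Σ[0… N ] (λ k → m * (ℕ→ℚ (c k) * β k))
      ≡⟨ Σ-cong N m*term ⟩
    Σ[0… N ] (λ k → ℕ→ℚ (c k ℕ.* α k) * β (suc k) + ℕ→ℚ (c k ℕ.* γ k) * β k)
      ≡⟨ Σ-distrib-+ N (λ k → ℕ→ℚ (c k ℕ.* α k) * β (suc k)) (λ k → ℕ→ℚ (c k ℕ.* γ k) * β k) ⟩
    Σ[0… N ] (λ k → ℕ→ℚ (c k ℕ.* α k) * β (suc k)) + expand cγ N
      ≡⟨ cong₂ _+_ (expand-shift N (λ j → c j ℕ.* α j)) (expand-suc N cγ (cong (ℕ._* γ (suc N)) c[1+N]≡0)) ⟨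
    expand (shift (λ j → c j ℕ.* α j)) (suc N) + expand cγ (suc N) ∎
    where
    open ≡-Reasoning
    cγ : ℕ → ℕ
    cγ k = c k ℕ.* γ k
    m*term : ∀ k → m * (ℕ→ℚ (c k) * β k) ≡ ℕ→ℚ (c k ℕ.* α k) * β (suc k) + ℕ→ℚ (c k ℕ.* γ k) * β k
    m*term k = begin
      m * (ℕ→ℚ (c k) * β k)
        ≡⟨ x∙yz≈y∙xz m (ℕ→ℚ (c k)) (β k) ⟩
      ℕ→ℚ (c k) * (m * β k)
        ≡⟨ cong (ℕ→ℚ (c k) *_) (m*β k) ⟩
      ℕ→ℚ (c k) * (ℕ→ℚ (α k) * β (suc k) + ℕ→ℚ (γ k) * β k)
        ≡⟨ ℚP.*-distribˡ-+ (ℕ→ℚ (c k)) (ℕ→ℚ (α k) * β (suc k)) (ℕ→ℚ (γ k) * β k) ⟩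
      ℕ→ℚ (c k) * (ℕ→ℚ (α k) * β (suc k)) + ℕ→ℚ (c k) * (ℕ→ℚ (γ k) * β k)
        ≡⟨ cong₂ _+_ (ℕ→ℚ-*-assoc (c k) (α k) (β (suc k))) (ℕ→ℚ-*-assoc (c k) (γ k) (β k)) ⟨
      ℕ→ℚ (c k ℕ.* α k) * β (suc k) + ℕ→ℚ (c k ℕ.* γ k) * β k ∎

  expand-recurrence : ∀ N p q (a b c : ℕ → ℕ) →
    (∀ k → p ℕ.* a k ≡ shift (λ j → c j ℕ.* α j) k ℕ.+ c k ℕ.* γ k ℕ.+ q ℕ.* b k) →
    c VanishesBeyond suc N → b VanishesBeyond N →
    ℕ→ℚ p * expand a (2 ℕ.+ N) ≡ m * expand c (suc N) + ℕ→ℚ q * expand b N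
  expand-recurrence N p q a b c rec c≈0 b≈0 = begin
    ℕ→ℚ p * expand a (2 ℕ.+ N)
      ≡⟨ expand-* (2 ℕ.+ N) p a ⟨
    expand (λ k → p ℕ.* a k) (2 ℕ.+ N)
      ≡⟨ expand-cong (2 ℕ.+ N) (λ k → p ℕ.* a k) (λ k → cα k ℕ.+ cγ k ℕ.+ q ℕ.* b k) rec ⟩
    expand (λ k → cα k ℕ.+ cγ k ℕ.+ q ℕ.* b k) (2 ℕ.+ N)
      ≡⟨ expand-+ (2 ℕ.+ N) (λ k → cα k ℕ.+ cγ k) (λ k → q ℕ.* b k) ⟩
    expand (λ k → cα k ℕ.+ cγ k) (2 ℕ.+ N) + expand (λ k → q ℕ.* b k) (2 ℕ.+ N)
      ≡⟨ cong₂ _+_ (expand-+ (2 ℕ.+ N) cα cγ) (expand-* (2 ℕ.+ N) q b) ⟩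
    expand cα (2 ℕ.+ N) + expand cγ (2 ℕ.+ N) + ℕ→ℚ q * expand b (2 ℕ.+ N)
      ≡⟨ cong₂ _+_ (sym (*-expand (suc N) c (c≈0 (ℕP.n<1+n (suc N))))) (cong (ℕ→ℚ q *_) (expand-extend b≈0 2)) ⟩
    m * expand c (suc N) + ℕ→ℚ q * expand b N ∎
    where
    open ≡-Reasoning
    cα cγ : ℕ → ℕ
    cα = shift (λ j → c j ℕ.* α j)
    cγ k = c k ℕ.* γ k

module Squares
  (m : ℚ) (p D S T : ℕ → ℚ) (p-nonZero : ∀ n → NonZero (p n))
  (D-rec : ∀ n → p (suc n) * D (2 ℕ.+ n) ≡ m * D (suc n) + p n * D n)
  (T-rec : ∀ n → T (suc n) ≡ S (suc n) + T n)
  (S-rec : ∀ n → p (suc n) * p (suc n) * S (2 ℕ.+ n) ≡ m * m * (T (suc n) + T n) + p n * p n * S n)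
  (D₀² : D 0 * D 0 ≡ S 0) (D₁² : D 1 * D 1 ≡ S 1) (D₀D₁ : p 0 * (D 0 * D 1) ≡ m * T 0)
  where

  Invariant : ℕ → Set
  Invariant n = D n * D n ≡ S n × D (suc n) * D (suc n) ≡ S (suc n) × p n * (D n * D (suc n)) ≡ m * T n

  invariant-suc : ∀ n → Invariant n → Invariant (suc n)
  invariant-suc n (d₀²≡s₀ , d₁²≡s₁ , p₀d₀d₁≡mt₀) = d₁²≡s₁ , d₂²≡s₂ , p₁d₁d₂≡mt₁
    where
    open ≡-Reasoning
    open +-*-Solver
    p₀ p₁ d₀ d₁ d₂ : ℚ
    p₀ = p n
    p₁ = p (suc n)
    d₀ = D n
    d₁ = D (suc n)
    d₂ = D (2 ℕ.+ n)

    p₁d₁d₂≡mt₁ : p₁ * (d₁ * d₂) ≡ m * T (suc n)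
    p₁d₁d₂≡mt₁ = begin
      p₁ * (d₁ * d₂)                  ≡⟨ x∙yz≈y∙xz p₁ d₁ d₂ ⟩
      d₁ * (p₁ * d₂)                  ≡⟨ cong (d₁ *_) (D-rec n) ⟩
      d₁ * (m * d₁ + p₀ * d₀)
        ≡⟨ solve 4 (λ d₁ m p₀ d₀ → d₁ :* (m :* d₁ :+ p₀ :* d₀) := m :* (d₁ :* d₁) :+ p₀ :* (d₀ :* d₁))
             refl d₁ m p₀ d₀ ⟩
      m * (d₁ * d₁) + p₀ * (d₀ * d₁)  ≡⟨ cong₂ (λ u v → m * u + v) d₁²≡s₁ p₀d₀d₁≡mt₀ ⟩
      m * S (suc n) + m * T n         ≡⟨ ℚP.*-distribˡ-+ m (S (suc n)) (T n) ⟨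
      m * (S (suc n) + T n)           ≡⟨ cong (m *_) (T-rec n) ⟨
      m * T (suc n)                   ∎

    d₂²≡s₂ : d₂ * d₂ ≡ S (2 ℕ.+ n)
    d₂²≡s₂ = *-cancelˡ-square p₁ {{p-nonZero (suc n)}} (begin
      p₁ * p₁ * (d₂ * d₂)
        ≡⟨ *-interchange p₁ p₁ d₂ d₂ ⟩
      (p₁ * d₂) * (p₁ * d₂)
        ≡⟨ cong (λ t → t * t) (D-rec n) ⟩
      (m * d₁ + p₀ * d₀) * (m * d₁ + p₀ * d₀)
        ≡⟨ solve 4 (λ m d₁ p₀ d₀ → (m :* d₁ :+ p₀ :* d₀) :* (m :* d₁ :+ p₀ :* d₀)
                     := m :* m :* (d₁ :* d₁) :+ (m :+ m) :* (p₀ :* (d₀ :* d₁)) :+ p₀ :* p₀ :* (d₀ :* d₀))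
             refl m d₁ p₀ d₀ ⟩
      m * m * (d₁ * d₁) + (m + m) * (p₀ * (d₀ * d₁)) + p₀ * p₀ * (d₀ * d₀)
        ≡⟨ cong₂ (λ u v → m * m * u + (m + m) * v + p₀ * p₀ * (d₀ * d₀)) d₁²≡s₁ p₀d₀d₁≡mt₀ ⟩
      m * m * S (suc n) + (m + m) * (m * T n) + p₀ * p₀ * (d₀ * d₀)
        ≡⟨ cong (λ u → m * m * S (suc n) + (m + m) * (m * T n) + p₀ * p₀ * u) d₀²≡s₀ ⟩
      m * m * S (suc n) + (m + m) * (m * T n) + p₀ * p₀ * S n
        ≡⟨ solve 5 (λ m s t q s₀ → m :* m :* s :+ (m :+ m) :* (m :* t) :+ q :* s₀
                                   := m :* m :* ((s :+ t) :+ t) :+ q :* s₀)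
             refl m (S (suc n)) (T n) (p₀ * p₀) (S n) ⟩
      m * m * ((S (suc n) + T n) + T n) + p₀ * p₀ * S n
        ≡⟨ cong (λ t → m * m * (t + T n) + p₀ * p₀ * S n) (T-rec n) ⟨
      m * m * (T (suc n) + T n) + p₀ * p₀ * S n
        ≡⟨ S-rec n ⟨
      p₁ * p₁ * S (2 ℕ.+ n) ∎)

  invariant : ∀ n → Invariant n
  invariant zero    = D₀² , D₁² , D₀D₁
  invariant (suc n) = invariant-suc n (invariant n)

  D²≡S : ∀ n → D n * D n ≡ S n
  D²≡S n = proj₁ (invariant n)

module _ (x : ℚ) where

  m : ℚ
  m = x + x + 1ℚ

  β w : ℕ → ℚ
  β k = binom x k * ℕ→ℚ (2 ℕ.^ k)
  w k = binom x k * binom (x + ℕ→ℚ k) k * ℕ→ℚ (4 ℕ.^ k)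

  m*β : ∀ k → m * β k ≡ ℕ→ℚ (suc k) * β (suc k) + ℕ→ℚ (odd k) * β k
  m*β k = begin
    m * (b₀ * P)
      ≡⟨ solve 4 (λ x b₀ P K → (x :+ x :+ con 1ℚ) :* (b₀ :* P)
                   := b₀ :* (x :- K) :* (con (ℕ→ℚ 2) :* P) :+ (con 1ℚ :+ con (ℕ→ℚ 2) :* K) :* (b₀ :* P))
           refl x b₀ P K ⟩
    b₀ * (x - K) * (ℕ→ℚ 2 * P) + (1ℚ + ℕ→ℚ 2 * K) * (b₀ * P)
      ≡⟨ cong₂ (λ u v → u * (ℕ→ℚ 2 * P) + v * (b₀ * P)) (binom-suc x k) (ℕ→ℚ-odd k) ⟨
    b₁ * ℕ→ℚ (suc k) * (ℕ→ℚ 2 * P) + ℕ→ℚ (odd k) * (b₀ * P)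
      ≡⟨ cong (_+ ℕ→ℚ (odd k) * (b₀ * P)) (xy∙z≈y∙xz b₁ (ℕ→ℚ (suc k)) (ℕ→ℚ 2 * P)) ⟩
    ℕ→ℚ (suc k) * (b₁ * (ℕ→ℚ 2 * P)) + ℕ→ℚ (odd k) * (b₀ * P)
      ≡⟨ cong (λ t → ℕ→ℚ (suc k) * (b₁ * t) + ℕ→ℚ (odd k) * (b₀ * P)) (ℕ→ℚ-* 2 (2 ℕ.^ k)) ⟨
    ℕ→ℚ (suc k) * β (suc k) + ℕ→ℚ (odd k) * β k ∎
    where
    open ≡-Reasoning
    open +-*-Solver
    b₀ b₁ K P : ℚ
    b₀ = binom x k
    b₁ = binom x (suc k)
    K = ℕ→ℚ k
    P = ℕ→ℚ (2 ℕ.^ k)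

  m²*w : ∀ k → m * m * w k ≡ ℕ→ℚ (suc k ²) * w (suc k) + ℕ→ℚ (odd k ²) * w k
  m²*w k = begin
    m * m * (b₀ * c₀ * P)
      ≡⟨ solve 5 (λ x b₀ c₀ P K → (x :+ x :+ con 1ℚ) :* (x :+ x :+ con 1ℚ) :* (b₀ :* c₀ :* P)
                   := b₀ :* (x :- K) :* ((x :+ K :+ con 1ℚ) :* c₀) :* (con (ℕ→ℚ 4) :* P)
                      :+ (con 1ℚ :+ con (ℕ→ℚ 2) :* K) :* (con 1ℚ :+ con (ℕ→ℚ 2) :* K) :* (b₀ :* c₀ :* P))
           refl x b₀ c₀ P K ⟩
    b₀ * (x - K) * ((x + K + 1ℚ) * c₀) * (ℕ→ℚ 4 * P) + (1ℚ + ℕ→ℚ 2 * K) * (1ℚ + ℕ→ℚ 2 * K) * (b₀ * c₀ * P)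
      ≡⟨ cong₂ (λ u v → u * (ℕ→ℚ 4 * P) + v * (b₀ * c₀ * P))
           (cong₂ _*_ (binom-suc x k) c₁*[1+k]) (cong₂ _*_ (ℕ→ℚ-odd k) (ℕ→ℚ-odd k)) ⟨
    b₁ * S₁ * (c₁ * S₁) * (ℕ→ℚ 4 * P) + ℕ→ℚ (odd k) * ℕ→ℚ (odd k) * w k
      ≡⟨ cong (_+ ℕ→ℚ (odd k) * ℕ→ℚ (odd k) * w k)
           (solve 5 (λ b₁ S₁ c₁ F P → b₁ :* S₁ :* (c₁ :* S₁) :* (F :* P) := S₁ :* S₁ :* (b₁ :* c₁ :* (F :* P)))
              refl b₁ S₁ c₁ (ℕ→ℚ 4) P) ⟩
    S₁ * S₁ * (b₁ * c₁ * (ℕ→ℚ 4 * P)) + ℕ→ℚ (odd k) * ℕ→ℚ (odd k) * w k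
      ≡⟨ cong (λ t → S₁ * S₁ * (b₁ * c₁ * t) + ℕ→ℚ (odd k) * ℕ→ℚ (odd k) * w k) (ℕ→ℚ-* 4 (4 ℕ.^ k)) ⟨
    S₁ * S₁ * w (suc k) + ℕ→ℚ (odd k) * ℕ→ℚ (odd k) * w k
      ≡⟨ cong₂ (λ u v → u * w (suc k) + v * w k) (ℕ→ℚ-* (suc k) (suc k)) (ℕ→ℚ-* (odd k) (odd k)) ⟨
    ℕ→ℚ (suc k ²) * w (suc k) + ℕ→ℚ (odd k ²) * w k ∎
    where
    open ≡-Reasoning
    open +-*-Solver
    b₀ b₁ c₀ c₁ K S₁ P : ℚ
    b₀ = binom x k
    b₁ = binom x (suc k)
    c₀ = binom (x + K) k
    c₁ = binom (x + ℕ→ℚ (suc k)) (suc k)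
    K = ℕ→ℚ k
    S₁ = ℕ→ℚ (suc k)
    P = ℕ→ℚ (4 ℕ.^ k)
    c₁*[1+k] : c₁ * S₁ ≡ (x + K + 1ℚ) * c₀
    c₁*[1+k] = begin
      c₁ * S₁
        ≡⟨ cong (λ z → binom z (suc k) * S₁)
             (trans (cong (x +_) (ℕ→ℚ-+ 1 k))
                    (solve 2 (λ x K → x :+ (con 1ℚ :+ K) := x :+ K :+ con 1ℚ) refl x K)) ⟩
      binom (x + K + 1ℚ) (suc k) * S₁
        ≡⟨ binom-+1-suc (x + K) k ⟩
      (x + K + 1ℚ) * c₀ ∎

  module Bβ = Bidiagonal m β suc odd m*β
  module Bw = Bidiagonal (m * m) w (_² ∘ suc) (_² ∘ odd) m²*w

  D S T : ℕ → ℚ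
  D n = Bβ.expand (n C_) n
  S n = Bw.expand (evenC n) n
  T n = Bw.expand (oddC n) n

  D-recurrence : ∀ n → ℕ→ℚ (2 ℕ.+ n) * D (2 ℕ.+ n) ≡ m * D (suc n) + ℕ→ℚ (suc n) * D n
  D-recurrence n = Bβ.expand-recurrence n (2 ℕ.+ n) (suc n) ((2 ℕ.+ n) C_) (n C_) (suc n C_)
    (C-recurrence n) k>n⇒nCk≡0 k>n⇒nCk≡0

  T-recurrence : ∀ n → T (suc n) ≡ S (suc n) + T n
  T-recurrence n = begin
    Bw.expand (oddC (suc n)) (suc n)
      ≡⟨ Bw.expand-cong (suc n) (oddC (suc n)) (λ k → evenC (suc n) k ℕ.+ oddC n k) (oddC-pascal n) ⟩
    Bw.expand (λ k → evenC (suc n) k ℕ.+ oddC n k) (suc n)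
      ≡⟨ Bw.expand-+ (suc n) (evenC (suc n)) (oddC n) ⟩
    S (suc n) + Bw.expand (oddC n) (suc n)
      ≡⟨ cong (S (suc n) +_) (Bw.expand-extend (oddC-vanishes n) 1) ⟩
    S (suc n) + T n ∎
    where open ≡-Reasoning

  S-recurrence : ∀ n →
    ℕ→ℚ (2 ℕ.+ n) * ℕ→ℚ (2 ℕ.+ n) * S (2 ℕ.+ n)
      ≡ m * m * (T (suc n) + T n) + ℕ→ℚ (suc n) * ℕ→ℚ (suc n) * S n
  S-recurrence n = begin
    ℕ→ℚ (2 ℕ.+ n) * ℕ→ℚ (2 ℕ.+ n) * S (2 ℕ.+ n)
      ≡⟨ cong (_* S (2 ℕ.+ n)) (ℕ→ℚ-* (2 ℕ.+ n) (2 ℕ.+ n)) ⟨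
    ℕ→ℚ ((2 ℕ.+ n) ²) * S (2 ℕ.+ n)
      ≡⟨ Bw.expand-recurrence n ((2 ℕ.+ n) ²) (suc n ²) (evenC (2 ℕ.+ n)) (evenC n) c
           (evenC-recurrence n) c-vanishes (evenC-vanishes n) ⟩
    m * m * Bw.expand c (suc n) + ℕ→ℚ (suc n ²) * S n
      ≡⟨ cong₂ (λ u v → m * m * u + v * S n)
           (trans (Bw.expand-+ (suc n) (oddC (suc n)) (oddC n))
                  (cong (T (suc n) +_) (Bw.expand-extend (oddC-vanishes n) 1)))
           (ℕ→ℚ-* (suc n) (suc n)) ⟩
    m * m * (T (suc n) + T n) + ℕ→ℚ (suc n) * ℕ→ℚ (suc n) * S n ∎
    where
    open ≡-Reasoning
    c : ℕ → ℕ
    c k = oddC (suc n) k ℕ.+ oddC n k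
    c-vanishes : c VanishesBeyond suc n
    c-vanishes n+1<k =
      cong₂ ℕ._+_ (oddC-vanishes (suc n) n+1<k) (oddC-vanishes n (ℕP.<-trans (ℕP.n<1+n n) n+1<k))

  D₁≡m : D 1 ≡ m
  D₁≡m = trans (ℚP.+-comm (ℕ→ℚ 1 * β 0) (ℕ→ℚ 1 * β 1)) (trans (sym (m*β 0)) (ℚP.*-identityʳ m))

  S₁≡m² : S 1 ≡ m * m
  S₁≡m² = trans (ℚP.+-comm (ℕ→ℚ 1 * w 0) (ℕ→ℚ 1 * w 1)) (trans (sym (m²*w 0)) (ℚP.*-identityʳ (m * m)))

  D²≡S : ∀ n → D n * D n ≡ S n
  D²≡S = Squares.D²≡S m (ℕ→ℚ ∘ suc) D S T (λ n → ℕ→ℚ-nonZero (suc n))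
    D-recurrence T-recurrence S-recurrence
    refl
    (trans (cong₂ _*_ D₁≡m D₁≡m) (sym S₁≡m²))
    (trans (ℚP.*-identityˡ (D 0 * D 1)) (trans (ℚP.*-identityˡ (D 1)) (trans D₁≡m (sym (ℚP.*-identityʳ m)))))

lemma3p1 : (n : ℕ) (x : ℚ) →
    d n x * d n x
    ≡ Σ[0… n ] (λ k → ℕ→ℚ ((n ℕ.+ k) C (2 ℕ.* k)) * binom x k * binom (x + ℕ→ℚ k) k * ℕ→ℚ (4 ℕ.^ k))
lemma3p1 n x = begin
  d n x * d n x  ≡⟨ cong₂ _*_ d≡D d≡D ⟩
  D x n * D x n  ≡⟨ D²≡S x n ⟩
  S x n          ≡⟨ Σ-cong n reassociate ⟨
  Σ[0… n ] (λ k → ℕ→ℚ ((n ℕ.+ k) C (2 ℕ.* k)) * binom x k * binom (x + ℕ→ℚ k) k * ℕ→ℚ (4 ℕ.^ k)) ∎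
  where
  open ≡-Reasoning
  d≡D : d n x ≡ D x n
  d≡D = Σ-cong n (λ k → ℚP.*-assoc (ℕ→ℚ (n C k)) (binom x k) (ℕ→ℚ (2 ℕ.^ k)))
  reassociate : ∀ k →
    ℕ→ℚ (evenC n k) * binom x k * binom (x + ℕ→ℚ k) k * ℕ→ℚ (4 ℕ.^ k) ≡ ℕ→ℚ (evenC n k) * w x k
  reassociate k = trans
    (cong (_* ℕ→ℚ (4 ℕ.^ k)) (ℚP.*-assoc (ℕ→ℚ (evenC n k)) (binom x k) (binom (x + ℕ→ℚ k) k)))
    (ℚP.*-assoc (ℕ→ℚ (evenC n k)) (binom x k * binom (x + ℕ→ℚ k) k) (ℕ→ℚ (4 ℕ.^ k)))
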